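{- Let $N>1$ and $0\le n\le N-1$ be integers with $\gcd(N,n)>1$ and $\gcd(N,n+1)>1$. Then $m=N-n-1$ also satisfies $0\le m\le N-1$, $\gcd(N,m)>1$ and $\gcd(N,m+1)>1$, and $c(N,n)=c(N,N-n-1)$.
   Context: For $\alpha\in\mathbb{C}$, $r\ge 0$ let $D(\alpha,r)=\{z:|z-\alpha|\le r\}$; for a rational $a/b\in[0,1]$ in lowest terms ($b>0$) let $D_{a/b}=D(a/b,1/b)$. For an integer $N>1$ let $\mathcal{R}_N=\bigcup D_{a/b}$ over all rationals $a/b\in[0,1]$ in lowest terms with $N\mid b$, and let $S_N$ be the unique minimal finite set of such rationals with $\mathcal{R}_N=\bigcup_{\alpha\in S_N}D_\alpha$. For a rational $\alpha=a/b$ in lowest terms, $P_\alpha=\frac ab+\frac1b i$ and $c(P_\alpha)=\#\{\beta\in S_N: P_\alpha\in D_\beta\}$. For integers $0\le n\le N-1$ with $\gcd(N,n)>1$, let $n'$ be the smallest integer with $n<n'\le N$ and $\gcd(N,n')>1$; $\mathcal{R}_{N,n}=\{z\in\mathcal{R}_N: n/N\le\operatorname{Re}z\le n'/N\}$ (which equals the union of $D_{a/b}$ over rationals $a/b$ in lowest terms with $N\mid b$ and $n/N\le a/b\le n'/N$), $S_{N,n}$ is the unique minimal finite set of such rationals with $\mathcal{R}_{N,n}=\bigcup_{\alpha\in S_{N,n}}D_\alpha$, and $c(N,n)=\max_{\alpha\in S_{N,n}}c(P_\alpha)$. -}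

module Defs where

open import Data.Nat as ℕ using (ℕ; zero; suc; _<_; _⊔_; _∸_)
open import Data.Nat.Divisibility using (_∣_)
open import Data.Nat.GCD using (gcd)
open import Data.Nat.Properties using (_<?_)
open import Data.Integer using (+_)
open import Data.Rational as ℚ using (ℚ; 0ℚ; 1ℚ; ↧ₙ_)
open import Data.Rational.Properties using (_≤?_)
open import Data.Product using (_×_; _,_; Σ)
open import Data.List using (List; length; filter; map; foldr)
open import Data.List.Relation.Unary.All using (All)
open import Data.List.Relation.Unary.Any using (Any)
open import Data.List.Relation.Unary.Unique.Propositional using (Unique)
open import Data.List.Membership.Propositional using (_∈_)
open import Relation.Nullary using (Dec; yes; no)
open import Relation.Unary using (Pred)

-- Points of the plane with rational coordinates: (Re z , Im z).
Point : Set
Point = ℚ × ℚ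

-- n / N as a rational (N = 0 never used; fallback 0).
frac : ℕ → ℕ → ℚ
frac n zero    = 0ℚ
frac n (suc k) = (+ n) ℚ./ suc k

radius : ℚ → ℚ
radius q = (+ 1) ℚ./ (↧ₙ q)

InDisk : Point → ℚ → Set
InDisk (x , y) q = ((x ℚ.- q) ℚ.* (x ℚ.- q)) ℚ.+ (y ℚ.* y) ℚ.≤ radius q ℚ.* radius q

inDisk? : (z : Point) (q : ℚ) → Dec (InDisk z q)
inDisk? (x , y) q = ((x ℚ.- q) ℚ.* (x ℚ.- q)) ℚ.+ (y ℚ.* y) ≤? radius q ℚ.* radius q

Adm : ℕ → ℚ → Set
Adm N q = (0ℚ ℚ.≤ q) × (q ℚ.≤ 1ℚ) × (N ∣ ↧ₙ q)

-- n' = smallest integer with n < n' ≤ N and gcd(N,n') > 1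
-- (search k = n+1, n+2, ... ; returns N if nothing smaller is found)
nextAux : ℕ → ℕ → ℕ → ℕ
nextAux N zero    k = k
nextAux N (suc f) k with 1 <? gcd N k
... | yes _ = k
... | no  _ = nextAux N f (suc k)

next : ℕ → ℕ → ℕ
next N n = nextAux N (N ∸ n ∸ 1) (suc n)

AdmR : ℕ → ℕ → ℚ → Set
AdmR N n q = Adm N q × (frac n N ℚ.≤ q) × (q ℚ.≤ frac (next N n) N)

-- S ⊆ family P, and ⋃_{α∈S} D_α ⊇ ⋃_{q ∈ P} D_q  (tested on rational points)
Covers : Pred ℚ _ → List ℚ → Set
Covers P S = All P S × (∀ (z : Point) (q : ℚ) → P q → InDisk z q → Any (InDisk z) S)

-- S (as a duplicate-free list = finite set) is an inclusion-minimal cover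
MinimalCover : Pred ℚ _ → List ℚ → Set
MinimalCover P S =
  Unique S × Covers P S ×
  (∀ (T : List ℚ) → Covers P T → (∀ {x} → x ∈ T → x ∈ S) → ∀ {x} → x ∈ S → x ∈ T)

Pt : ℚ → Point
Pt q = q , radius q

cnt : List ℚ → ℚ → ℕ
cnt SN α = length (filter (inDisk? (Pt α)) SN)

cmax : List ℚ → List ℚ → ℕ
cmax SN S = foldr _⊔_ 0 (map (cnt SN) S)

{-# OPTIONS --safe --with-K #-}

-- The reflection q ↦ 1 - q keeps denominators, hence maps each disk D_{a/b} onto the disk
-- D_{1-a/b} of the same radius and preserves the condition N ∣ b. Since gcd(N, n+1) > 1 and
-- gcd(N, m+1) > 1 we have n' = n + 1 and m' = m + 1, so it also exchanges the strips
-- [n/N, (n+1)/N] and [m/N, (m+1)/N]. Minimal covers are unique (every minimal cover is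
-- contained in every cover), so the reflection maps S_N onto itself and S_{N,m} onto S_{N,n}.
-- Finally P_{1-α} ∈ D_{1-β} iff P_α ∈ D_β, so c(P_{1-α}) = c(P_α) and c(N,n) = c(N,m).

module Submission where

open import Defs

module Disks where

  open import Data.Empty using (⊥; ⊥-elim)
  open import Data.Integer as ℤ using (+_; +≤+; +<+; -≤+)
  import Data.Integer.Properties as ℤ
  import Data.Integer.Solver as ℤ-Solver
  open import Data.List using (List; []; _∷_; filter; map)
  open import Data.List.Membership.Propositional using (_∈_; _∉_; find; lose)
  open import Data.List.Membership.Propositional.Properties using (∈-filter⁺; ∈-filter⁻; ∈-map⁻)
  open import Data.List.Membership.Propositional.Properties.WithK using (unique∧set⇒bag)
  open import Data.List.Relation.Binary.BagAndSetEquality using (∼bag⇒↭)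
  open import Data.List.Relation.Binary.Permutation.Propositional using (_↭_)
  open import Data.List.Relation.Unary.All as All using (All; []; _∷_)
  import Data.List.Relation.Unary.All.Properties as All
  open import Data.List.Relation.Unary.Any as Any using (Any)
  import Data.List.Relation.Unary.Any.Properties as Any
  import Data.List.Relation.Unary.Unique.Propositional.Properties as Unique
  open import Data.Nat as ℕ using (ℕ; zero; suc; z≤n; s≤s; _∸_)
  open import Data.Nat.Divisibility using (_∣_; divides; ∣-antisym)
  import Data.Nat.Properties as ℕ
  open import Data.Product using (∃; _×_; _,_; proj₁; proj₂)
  open import Data.Rational as ℚ using (ℚ; 0ℚ; 1ℚ; _+_; _-_; _*_; _≤_; _<_; ↥_; mkℚ; *≤*; *<*)
  open import Data.Rational.Literals using (fromℤ)
  import Data.Rational.Properties as ℚ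
  open import Data.List.Membership.DecPropositional ℚ._≟_ using (_∈?_)
  open import Data.Rational.Solver using (module +-*-Solver)
  import Data.Rational.Unnormalised.Base as ℚᵘ
  import Data.Rational.Unnormalised.Properties as ℚᵘ
  open import Data.Sum using (_⊎_; inj₁; inj₂)
  open import Function using (_∘_; id)
  open import Function.Bundles using (_⇔_; mk⇔; Equivalence)
  open import Relation.Binary.Definitions using (tri<; tri≈; tri>)
  open import Relation.Binary.PropositionalEquality
  open import Relation.Nullary using (¬_; Dec; yes; no; ¬?)
  open import Relation.Nullary.Decidable using (decidable-stable)
  open import Relation.Unary using (Decidable)

  open +-*-Solver

  p≤q⇒0≤q-p : ∀ {p q} → p ≤ q → 0ℚ ≤ q - p
  p≤q⇒0≤q-p {p} {q} p≤q =
    subst (_≤ q - p) (solve 1 (λ p → p :- p := con 0ℚ) refl p) (ℚ.+-monoˡ-≤ (ℚ.- p) p≤q)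

  0≤q-p⇒p≤q : ∀ {p q} → 0ℚ ≤ q - p → p ≤ q
  0≤q-p⇒p≤q {p} {q} 0≤q-p =
    subst₂ _≤_ (ℚ.+-identityʳ p) (solve 2 (λ p q → p :+ (q :- p) := q) refl p q) (ℚ.+-monoʳ-≤ p 0≤q-p)

  p<q⇒0<q-p : ∀ {p q} → p < q → 0ℚ < q - p
  p<q⇒0<q-p {p} {q} p<q =
    subst (_< q - p) (solve 1 (λ p → p :- p := con 0ℚ) refl p) (ℚ.+-monoˡ-< (ℚ.- p) p<q)

  0<q-p⇒p<q : ∀ {p q} → 0ℚ < q - p → p < q
  0<q-p⇒p<q {p} {q} 0<q-p =
    subst₂ _<_ (ℚ.+-identityʳ p) (solve 2 (λ p q → p :+ (q :- p) := q) refl p q) (ℚ.+-monoʳ-< p 0<q-p)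

  p+q≤r⇒q≤r-p : ∀ {p q r} → p + q ≤ r → q ≤ r - p
  p+q≤r⇒q≤r-p {p} {q} {r} p+q≤r =
    subst (_≤ r - p) (solve 2 (λ p q → p :+ q :- p := q) refl p q) (ℚ.+-monoˡ-≤ (ℚ.- p) p+q≤r)

  q≤r-p⇒p+q≤r : ∀ {p q r} → q ≤ r - p → p + q ≤ r
  q≤r-p⇒p+q≤r {p} {q} {r} q≤r-p =
    subst (p + q ≤_) (solve 2 (λ p r → p :+ (r :- p) := r) refl p r) (ℚ.+-monoʳ-≤ p q≤r-p)

  p≢q⇒p-q≢0 : ∀ {p q} → p ≢ q → p - q ≢ 0ℚ
  p≢q⇒p-q≢0 {p} {q} p≢q p-q≡0 = p≢q (begin
    p             ≡⟨ solve 2 (λ p q → p := (p :- q) :+ q) refl p q ⟩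
    (p - q) + q   ≡⟨ cong (_+ q) p-q≡0 ⟩
    0ℚ + q        ≡⟨ ℚ.+-identityˡ q ⟩
    q             ∎)
    where open ≡-Reasoning

  <⇒≱ : ∀ {p q} → p < q → ¬ q ≤ p
  <⇒≱ p<q q≤p = ℚ.<-irrefl refl (ℚ.<-≤-trans p<q q≤p)

  positive-sum : ∀ {e p q} → e ≡ p + q → 0ℚ < p → 0ℚ ≤ q → 0ℚ < e
  positive-sum refl 0<p 0≤q = ℚ.+-mono-<-≤ 0<p 0≤q

  *-nonNeg : ∀ {p q} → 0ℚ ≤ p → 0ℚ ≤ q → 0ℚ ≤ p * q
  *-nonNeg {p} {q} 0≤p 0≤q =
    ℚ.nonNegative⁻¹ _ {{ℚ.nonNeg*nonNeg⇒nonNeg p {{ℚ.nonNegative 0≤p}} q {{ℚ.nonNegative 0≤q}}}}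

  *-pos : ∀ {p q} → 0ℚ < p → 0ℚ < q → 0ℚ < p * q
  *-pos {p} {q} 0<p 0<q = ℚ.positive⁻¹ _ {{ℚ.pos*pos⇒pos p {{ℚ.positive 0<p}} q {{ℚ.positive 0<q}}}}

  square-nonNeg : ∀ p → 0ℚ ≤ p * p
  square-nonNeg p with ℚ.≤-total 0ℚ p
  ... | inj₁ 0≤p = *-nonNeg 0≤p 0≤p
  ... | inj₂ p≤0 = subst (0ℚ ≤_) (solve 1 (λ p → (con 0ℚ :- p) :* (con 0ℚ :- p) := p :* p) refl p)
                     (*-nonNeg (p≤q⇒0≤q-p p≤0) (p≤q⇒0≤q-p p≤0))

  square-pos : ∀ {p} → p ≢ 0ℚ → 0ℚ < p * p
  square-pos {p} p≢0 with ℚ.<-cmp p 0ℚ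
  ... | tri< p<0 _ _ = subst (0ℚ <_) (solve 1 (λ p → (con 0ℚ :- p) :* (con 0ℚ :- p) := p :* p) refl p)
                          (*-pos (p<q⇒0<q-p p<0) (p<q⇒0<q-p p<0))
  ... | tri≈ _ p≡0 _ = ⊥-elim (p≢0 p≡0)
  ... | tri> _ _ 0<p = *-pos 0<p 0<p

  ∃-inverse : ∀ {p} → 0ℚ < p → ∃ λ p⁻¹ → 0ℚ < p⁻¹ × p⁻¹ * p ≡ 1ℚ
  ∃-inverse {p} 0<p = ℚ.1/ p , ℚ.positive⁻¹ _ {{ℚ.1/pos⇒pos p}} , ℚ.*-inverseˡ p
    where
    instance
      positive-p : ℚ.Positive p
      positive-p = ℚ.positive 0<p
      nonZero-p : ℚ.NonZero p
      nonZero-p = ℚ.pos⇒nonZero p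

  0<1 : 0ℚ < 1ℚ
  0<1 = *<* (+<+ (s≤s z≤n))

  p<p+1 : ∀ p → p < p + 1ℚ
  p<p+1 p = 0<q-p⇒p<q (subst (0ℚ <_) (solve 1 (λ p → con 1ℚ := (p :+ con 1ℚ) :- p) refl p) 0<1)

  NearZero : (ℚ → Set) → Set
  NearZero P = ∃ λ δ → 0ℚ < δ × (∀ {d} → 0ℚ < d → d ≤ δ → P d)

  NearZero⇒∃ : ∀ {P} → NearZero P → ∃ λ d → 0ℚ < d × P d
  NearZero⇒∃ (δ , 0<δ , P) = δ , 0<δ , P 0<δ ℚ.≤-refl

  NearZero-map : ∀ {P Q} → (∀ {d} → 0ℚ < d → P d → Q d) → NearZero P → NearZero Q
  NearZero-map P⇒Q (δ , 0<δ , P) = δ , 0<δ , λ 0<d d≤δ → P⇒Q 0<d (P 0<d d≤δ)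

  NearZero-∩ : ∀ {P Q} → NearZero P → NearZero Q → NearZero (λ d → P d × Q d)
  NearZero-∩ (δ₁ , 0<δ₁ , P) (δ₂ , 0<δ₂ , Q) = δ₁ ℚ.⊓ δ₂ , 0<δ₁⊓δ₂ (ℚ.⊓-sel δ₁ δ₂) ,
    λ 0<d d≤δ → P 0<d (ℚ.p≤q⊓r⇒p≤q δ₁ δ₂ d≤δ) , Q 0<d (ℚ.p≤q⊓r⇒p≤r δ₁ δ₂ d≤δ)
    where
    0<δ₁⊓δ₂ : δ₁ ℚ.⊓ δ₂ ≡ δ₁ ⊎ δ₁ ℚ.⊓ δ₂ ≡ δ₂ → 0ℚ < δ₁ ℚ.⊓ δ₂
    0<δ₁⊓δ₂ (inj₁ eq) = subst (0ℚ <_) (sym eq) 0<δ₁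
    0<δ₁⊓δ₂ (inj₂ eq) = subst (0ℚ <_) (sym eq) 0<δ₂

  NearZero-All : ∀ {A : Set} {P : A → ℚ → Set} {xs} →
                 All (λ x → NearZero (P x)) xs → NearZero (λ d → All (λ x → P x d) xs)
  NearZero-All []         = 1ℚ , 0<1 , λ _ _ → []
  NearZero-All (nz ∷ nzs) = NearZero-map (λ _ (p , ps) → p ∷ ps) (NearZero-∩ nz (NearZero-All nzs))

  NearZero-≤1 : NearZero (_≤ 1ℚ)
  NearZero-≤1 = 1ℚ , 0<1 , λ _ d≤1 → d≤1

  NearZero-affine : ∀ {a} b → 0ℚ < a → NearZero (λ d → 0ℚ < a + b * d)
  NearZero-affine {a} b 0<a with ℚ.≤-total 0ℚ b
  ... | inj₁ 0≤b = 1ℚ , 0<1 , λ 0<d _ → ℚ.+-mono-<-≤ 0<a (*-nonNeg 0≤b (ℚ.<⇒≤ 0<d))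
  ... | inj₂ b≤0 = below-root (∃-inverse 0<a-b)
    where
    0<a-b : 0ℚ < a - b
    0<a-b = positive-sum (solve 2 (λ a b → a :- b := a :+ (con 0ℚ :- b)) refl a b) 0<a (p≤q⇒0≤q-p b≤0)
    -- With δ = a / (a - b) we get a + b δ = a δ > 0, and a + b d does not decrease as d decreases.
    below-root : (∃ λ i → 0ℚ < i × i * (a - b) ≡ 1ℚ) → NearZero (λ d → 0ℚ < a + b * d)
    below-root (i , 0<i , i[a-b]≡1) = a * i , *-pos 0<a 0<i , λ {d} _ d≤ai →
      positive-sum (eq d) (*-pos 0<a (*-pos 0<a 0<i)) (*-nonNeg (p≤q⇒0≤q-p b≤0) (p≤q⇒0≤q-p d≤ai))
      where
      eq : ∀ d → a + b * d ≡ a * (a * i) + (0ℚ - b) * (a * i - d)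
      eq d = begin
        a + b * d                             ≡⟨ cong (_+ b * d) (sym (ℚ.*-identityʳ a)) ⟩
        a * 1ℚ + b * d                        ≡⟨ cong (λ t → a * t + b * d) (sym i[a-b]≡1) ⟩
        a * (i * (a - b)) + b * d             ≡⟨ solve 4 (λ a b d i → a :* (i :* (a :- b)) :+ b :* d
                                                   := a :* (a :* i) :+ (con 0ℚ :- b) :* (a :* i :- d)) refl a b d i ⟩
        a * (a * i) + (0ℚ - b) * (a * i - d)  ∎
        where open ≡-Reasoning

  NearZero-quadratic : ∀ {a b c} → 0ℚ ≤ c → 0ℚ < a ⊎ (a ≡ 0ℚ × 0ℚ < b) →
                       NearZero (λ d → 0ℚ < a + b * d - c * (d * d))
  NearZero-quadratic {a} {b} {c} 0≤c (inj₁ 0<a) =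
    NearZero-map positive (NearZero-∩ NearZero-≤1 (NearZero-affine (b - c) 0<a))
    where
    positive : ∀ {d} → 0ℚ < d → d ≤ 1ℚ × 0ℚ < a + (b - c) * d → 0ℚ < a + b * d - c * (d * d)
    positive {d} 0<d (d≤1 , 0<a+[b-c]d) = positive-sum
      (solve 4 (λ a b c d → a :+ b :* d :- c :* (d :* d) := (a :+ (b :- c) :* d) :+ c :* (d :* (con 1ℚ :- d))) refl a b c d)
      0<a+[b-c]d (*-nonNeg 0≤c (*-nonNeg (ℚ.<⇒≤ 0<d) (p≤q⇒0≤q-p d≤1)))
  NearZero-quadratic {b = b} {c} 0≤c (inj₂ (refl , 0<b)) = NearZero-map positive (NearZero-affine (0ℚ - c) 0<b)
    where
    positive : ∀ {d} → 0ℚ < d → 0ℚ < b + (0ℚ - c) * d → 0ℚ < 0ℚ + b * d - c * (d * d)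
    positive {d} 0<d 0<b-cd = subst (0ℚ <_)
      (solve 3 (λ b c d → d :* (b :+ (con 0ℚ :- c) :* d) := con 0ℚ :+ b :* d :- c :* (d :* d)) refl b c d)
      (*-pos 0<d 0<b-cd)

  -- Rational squares are dense

  fromℕ : ℕ → ℚ
  fromℕ n = fromℤ (+ n)

  fromℕ-suc : ∀ n → fromℕ (suc n) ≡ fromℕ n + 1ℚ
  fromℕ-suc n = ℚ.toℚᵘ-injective (ℚᵘ.≃-trans (ℚᵘ.*≡* eq) (ℚᵘ.≃-sym (ℚ.toℚᵘ-homo-+ (fromℕ n) 1ℚ)))
    where
    eq : (+ 1 ℤ.+ + n) ℤ.* + 1 ≡ (+ n ℤ.* + 1 ℤ.+ + 1 ℤ.* + 1) ℤ.* + 1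
    eq = cong (ℤ._* + 1) (trans (ℤ.+-comm (+ 1) (+ n)) (cong (ℤ._+ + 1) (sym (ℤ.*-identityʳ (+ n)))))

  p≤fromℕ∣↥p∣ : ∀ p → p ≤ fromℕ ℤ.∣ ↥ p ∣
  p≤fromℕ∣↥p∣ (mkℚ (+ k) d _) =
    *≤* (subst₂ ℤ._≤_ (ℤ.pos-* k 1) (ℤ.pos-* k (suc d)) (+≤+ (ℕ.*-monoʳ-≤ k (s≤s z≤n))))
  p≤fromℕ∣↥p∣ (mkℚ ℤ.-[1+ _ ] _ _) = *≤* -≤+

  archimedean : ∀ p → ∃ λ k → p < fromℕ k
  archimedean p = suc n , ℚ.≤-<-trans (p≤fromℕ∣↥p∣ p) (subst (fromℕ n <_) (sym (fromℕ-suc n)) (p<p+1 (fromℕ n)))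
    where
    n : ℕ
    n = ℤ.∣ ↥ p ∣

  archimedean-multiple : ∀ {ε} → 0ℚ < ε → ∀ p → ∃ λ k → p < fromℕ k * ε
  archimedean-multiple {ε} 0<ε p = scale (∃-inverse 0<ε)
    where
    scale : (∃ λ ε⁻¹ → 0ℚ < ε⁻¹ × ε⁻¹ * ε ≡ 1ℚ) → ∃ λ k → p < fromℕ k * ε
    scale (ε⁻¹ , _ , ε⁻¹ε≡1) =
      let k , pε⁻¹<k = archimedean (p * ε⁻¹)
      in k , subst (_< fromℕ k * ε) p*ε⁻¹*ε≡p (ℚ.*-monoˡ-<-pos ε {{ℚ.positive 0<ε}} pε⁻¹<k)
      where
      p*ε⁻¹*ε≡p : p * ε⁻¹ * ε ≡ p
      p*ε⁻¹*ε≡p = trans (ℚ.*-assoc p ε⁻¹ ε) (trans (cong (p *_) ε⁻¹ε≡1) (ℚ.*-identityʳ p))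

  crossing : ∀ {P : ℕ → Set} → Decidable P → P 0 → ∀ k → ¬ P k → ∃ λ j → P j × ¬ P (suc j)
  crossing P? P0 zero    ¬P0   = ⊥-elim (¬P0 P0)
  crossing P? P0 (suc k) ¬Pk+1 with P? k
  ... | yes Pk = k , Pk , ¬Pk+1
  ... | no ¬Pk = crossing P? P0 k ¬Pk

  h+1<y⇒h<y*y : ∀ {h y} → 0ℚ ≤ h → h + 1ℚ < y → h < y * y
  h+1<y⇒h<y*y {h} {y} 0≤h h+1<y = 0<q-p⇒p<q (positive-sum eq (p<q⇒0<q-p h+1<y)
    (ℚ.+-mono-≤ (*-nonNeg (p≤q⇒0≤q-p 1≤y) (ℚ.≤-trans (ℚ.<⇒≤ 0<1) 1≤y)) (ℚ.<⇒≤ 0<1)))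
    where
    1≤y : 1ℚ ≤ y
    1≤y = ℚ.≤-trans (0≤q-p⇒p≤q (subst (0ℚ ≤_) (solve 1 (λ h → h := (h :+ con 1ℚ) :- con 1ℚ) refl h) 0≤h))
                    (ℚ.<⇒≤ h+1<y)
    eq : y * y - h ≡ (y - (h + 1ℚ)) + ((y - 1ℚ) * y + 1ℚ)
    eq = solve 2 (λ y h → y :* y :- h := (y :- (h :+ con 1ℚ)) :+ ((y :- con 1ℚ) :* y :+ con 1ℚ)) refl y h

  y*y≤h⇒y≤h+1 : ∀ {h y} → 0ℚ ≤ h → y * y ≤ h → y ≤ h + 1ℚ
  y*y≤h⇒y≤h+1 {h} {y} 0≤h y*y≤h with y ℚ.≤? h + 1ℚ
  ... | yes y≤h+1 = y≤h+1
  ... | no  y≰h+1 = ⊥-elim (<⇒≱ (h+1<y⇒h<y*y 0≤h (ℚ.≰⇒> y≰h+1)) y*y≤h)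

  grid-crossing : ∀ {h ε} k → 0ℚ ≤ h → h + 1ℚ < fromℕ k * ε →
                  ∃ λ y → y * y ≤ h × h < (y + ε) * (y + ε)
  grid-crossing {h} {ε} k 0≤h h+1<kε =
    let j , Pj , ¬Pj+1 = crossing (λ j → Y j * Y j ℚ.≤? h) P0 k (<⇒≱ (h+1<y⇒h<y*y 0≤h h+1<kε))
    in Y j , Pj , subst (λ t → h < t * t) (Y-suc j) (ℚ.≰⇒> ¬Pj+1)
    where
    Y : ℕ → ℚ
    Y j = fromℕ j * ε
    Y-suc : ∀ j → Y (suc j) ≡ Y j + ε
    Y-suc j = trans (cong (_* ε) (fromℕ-suc j)) (solve 2 (λ a e → (a :+ con 1ℚ) :* e := a :* e :+ e) refl (fromℕ j) ε)
    P0 : Y 0 * Y 0 ≤ h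
    P0 = subst (_≤ h) (solve 1 (λ e → con 0ℚ := (con 0ℚ :* e) :* (con 0ℚ :* e)) refl ε) 0≤h

  -- Since y ≤ h + 1 and ε ≤ 1, the step (y + ε)² - y² = ε (2y + ε) is at most ε (2 (h + 1) + 1).
  last-grid-square : ∀ {m h ε y} → 0ℚ ≤ h → 0ℚ ≤ ε → ε ≤ 1ℚ →
                     0ℚ < (h - m) + (ℚ.- ((h + 1ℚ) + (h + 1ℚ) + 1ℚ)) * ε →
                     y * y ≤ h → h < (y + ε) * (y + ε) → m < y * y
  last-grid-square {m} {h} {ε} {y} 0≤h 0≤ε ε≤1 ε-small y*y≤h h<[y+ε]² = 0<q-p⇒p<q (positive-sum eq
    (ℚ.+-mono-< (p<q⇒0<q-p h<[y+ε]²) ε-small)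
    (*-nonNeg 0≤ε (ℚ.+-mono-≤ (ℚ.+-mono-≤ 0≤h+1-y 0≤h+1-y) (p≤q⇒0≤q-p ε≤1))))
    where
    0≤h+1-y : 0ℚ ≤ (h + 1ℚ) - y
    0≤h+1-y = p≤q⇒0≤q-p (y*y≤h⇒y≤h+1 0≤h y*y≤h)
    eq : y * y - m ≡ (((y + ε) * (y + ε) - h) + ((h - m) + (ℚ.- ((h + 1ℚ) + (h + 1ℚ) + 1ℚ)) * ε))
                     + ε * ((((h + 1ℚ) - y) + ((h + 1ℚ) - y)) + (1ℚ - ε))
    eq = solve 4 (λ y m h ε →
      y :* y :- m := (((y :+ ε) :* (y :+ ε) :- h) :+ ((h :- m) :+ (:- ((h :+ con 1ℚ) :+ (h :+ con 1ℚ) :+ con 1ℚ)) :* ε))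
                     :+ ε :* ((((h :+ con 1ℚ) :- y) :+ ((h :+ con 1ℚ) :- y)) :+ (con 1ℚ :- ε))) refl y m h ε

  square-between : ∀ {m h} → 0ℚ ≤ m → m < h → ∃ λ y → m < y * y × y * y ≤ h
  square-between {m} {h} 0≤m m<h =
    let ε , 0<ε , ε≤1 , ε-small = NearZero⇒∃ (NearZero-∩ NearZero-≤1 (NearZero-affine (ℚ.- c) (p<q⇒0<q-p m<h)))
        k , h+1<kε = archimedean-multiple 0<ε (h + 1ℚ)
        y , y*y≤h , h<[y+ε]² = grid-crossing {ε = ε} k 0≤h h+1<kε
    in y , last-grid-square {m} {h} {ε} {y} 0≤h (ℚ.<⇒≤ 0<ε) ε≤1 ε-small y*y≤h h<[y+ε]² , y*y≤h
    where
    c : ℚ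
    c = (h + 1ℚ) + (h + 1ℚ) + 1ℚ
    0≤h : 0ℚ ≤ h
    0≤h = ℚ.≤-trans 0≤m (ℚ.<⇒≤ m<h)

  ∃-upper-bound-below : ∀ {A : Set} {f : A → ℚ} {h xs} → 0ℚ < h → All (λ a → f a < h) xs →
                        ∃ λ m → 0ℚ ≤ m × m < h × All (λ a → f a ≤ m) xs
  ∃-upper-bound-below 0<h [] = 0ℚ , ℚ.≤-refl , 0<h , []
  ∃-upper-bound-below {f = f} {xs = a ∷ _} 0<h (fa<h ∷ fxs<h) with ∃-upper-bound-below 0<h fxs<h
  ... | m , 0≤m , m<h , fxs≤m with f a ℚ.≤? m
  ...   | yes fa≤m = m , 0≤m , m<h , fa≤m ∷ fxs≤m
  ...   | no  fa≰m = f a , ℚ.≤-trans 0≤m m≤fa , fa<h , ℚ.≤-refl ∷ All.map (λ fb≤m → ℚ.≤-trans fb≤m m≤fa) fxs≤m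
    where
    m≤fa : m ≤ f a
    m≤fa = ℚ.<⇒≤ (ℚ.≰⇒> fa≰m)

  square-above : ∀ {A : Set} {f : A → ℚ} {h xs} → 0ℚ ≤ h → All (λ a → f a < h) xs →
                 ∃ λ y → All (λ a → f a < y * y) xs × y * y ≤ h
  square-above {h = h} 0≤h fxs<h with 0ℚ ℚ.<? h
  ... | no 0≮h = 0ℚ , All.map (λ fa<h → ℚ.<-≤-trans fa<h (ℚ.≮⇒≥ 0≮h)) fxs<h , 0≤h
  ... | yes 0<h =
    let m , 0≤m , m<h , fxs≤m = ∃-upper-bound-below 0<h fxs<h
        y , m<y*y , y*y≤h = square-between 0≤m m<h
    in y , All.map (λ fa≤m → ℚ.≤-<-trans fa≤m m<y*y) fxs≤m , y*y≤h

  2ℚ : ℚ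
  2ℚ = fromℕ 2

  0<2 : 0ℚ < 2ℚ
  0<2 = *<* (+<+ (s≤s z≤n))

  0<radius : ∀ q → 0ℚ < radius q
  0<radius q = ℚ.positive⁻¹ (radius q) {{ℚ.normalize-pos 1 (ℚ.↧ₙ q)}}

  opaque
    height² : ℚ → ℚ → ℚ
    height² q x = radius q * radius q - (x - q) * (x - q)

    InDisk⇒≤height² : ∀ {x y q} → InDisk (x , y) q → y * y ≤ height² q x
    InDisk⇒≤height² {x} {y} {q} = p+q≤r⇒q≤r-p {(x - q) * (x - q)} {y * y} {radius q * radius q}

    ≤height²⇒InDisk : ∀ {x y q} → y * y ≤ height² q x → InDisk (x , y) q
    ≤height²⇒InDisk {x} {y} {q} = q≤r-p⇒p+q≤r {(x - q) * (x - q)} {y * y} {radius q * radius q}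

    height²-centre : ∀ q → height² q q ≡ radius q * radius q
    height²-centre q = solve 2 (λ r q → r :* r :- (q :- q) :* (q :- q) := r :* r) refl (radius q) q

    height²-shift : ∀ β x s d →
      height² β (x + s * d) ≡ height² β x + (2ℚ * (β - x) * s) * d - (s * s) * (d * d)
    height²-shift β x s d = solve 5 (λ r β x s d →
      r :* r :- ((x :+ s :* d) :- β) :* ((x :+ s :* d) :- β)
        := (r :* r :- (x :- β) :* (x :- β)) :+ (con 2ℚ :* (β :- x) :* s) :* d :- (s :* s) :* (d :* d))
      refl (radius β) β x s d

    -- All centres lie on the real axis, so the difference of two heights² is affine in x.
    height²-difference-shift : ∀ α β x s d →
      height² α (x + s * d) - height² β (x + s * d) ≡ (height² α x - height² β x) + (2ℚ * (α - β) * s) * d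
    height²-difference-shift α β x s d = solve 7 (λ rα rβ α β x s d →
      (rα :* rα :- ((x :+ s :* d) :- α) :* ((x :+ s :* d) :- α))
        :- (rβ :* rβ :- ((x :+ s :* d) :- β) :* ((x :+ s :* d) :- β))
        := ((rα :* rα :- (x :- α) :* (x :- α)) :- (rβ :* rβ :- (x :- β) :* (x :- β))) :+ (con 2ℚ :* (α :- β) :* s) :* d)
      refl (radius α) (radius β) α β x s d

  Dominates : ℚ → List ℚ → ℚ → Set
  Dominates α βs x = All (λ β → height² β x < height² α x) βs

  -- Covers are only tested at rational points, so a point of D_q outside every D_β is found
  -- as (x, y) with y rational and y² strictly between the heights² of the D_β and that of D_q.
  cover-reaches : ∀ {P S q x} → Covers P S → P q → 0ℚ ≤ height² q x →
                  Any (λ β → height² q x ≤ height² β x) S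
  cover-reaches {S = S} {q} {x} (_ , covers) Pq 0≤hq = decide (Any.any? (λ β → height² q x ℚ.≤? height² β x) S)
    where
    decide : Dec (Any (λ β → height² q x ≤ height² β x) S) → Any (λ β → height² q x ≤ height² β x) S
    decide (yes reached) = reached
    decide (no ¬reached) =
      let y , S<y*y , y*y≤hq = square-above {f = λ β → height² β x} 0≤hq (All.map ℚ.≰⇒> (All.¬Any⇒All¬ S ¬reached))
          β , β∈S , top∈Dβ = find (covers (x , y) q Pq (≤height²⇒InDisk {x} {y} {q} y*y≤hq))
      in ⊥-elim (<⇒≱ (All.lookup S<y*y β∈S) (InDisk⇒≤height² {x} {y} {β} top∈Dβ))

  cover-¬dominated : ∀ {P S q x} → Covers P S → P q → 0ℚ ≤ height² q x → ¬ Dominates q S x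
  cover-¬dominated S-covers Pq 0≤hq dominated =
    All.All¬⇒¬Any (All.map <⇒≱ dominated) (cover-reaches S-covers Pq 0≤hq)

  nudge : ∀ {α βs x} s → Dominates α βs x →
          0ℚ < height² α x ⊎ (height² α x ≡ 0ℚ × 0ℚ < 2ℚ * (α - x) * s) →
          ∃ λ d → 0ℚ < d × 0ℚ < height² α (x + s * d) × Dominates α βs (x + s * d)
  nudge {α} {βs} {x} s dominated start = NearZero⇒∃ (NearZero-∩ α-stays-up gaps-stay-open)
    where
    α-stays-up : NearZero (λ d → 0ℚ < height² α (x + s * d))
    α-stays-up = NearZero-map (λ {d} _ → subst (0ℚ <_) (sym (height²-shift α x s d)))
                              (NearZero-quadratic (square-nonNeg s) start)
    Gap : ℚ → ℚ → Set
    Gap β d = 0ℚ < (height² α x - height² β x) + (2ℚ * (α - β) * s) * d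
    gaps-stay-open : NearZero (λ d → Dominates α βs (x + s * d))
    gaps-stay-open = NearZero-map
      (λ {d} _ → All.map (λ {β} gap → 0<q-p⇒p<q (subst (0ℚ <_) (sym (height²-difference-shift α β x s d)) gap)))
      (NearZero-All {P = Gap} (All.map (λ {β} hβ<hα → NearZero-affine (2ℚ * (α - β) * s) (p<q⇒0<q-p hβ<hα)) dominated))

  height²-overtakes : ∀ {α t x d} → t ≢ α → height² α x ≤ height² t x → 0ℚ < d →
                      height² α (x + (t - α) * d) < height² t (x + (t - α) * d)
  height²-overtakes {α} {t} {x} {d} t≢α hα≤ht 0<d = 0<q-p⇒p<q (positive-sum
    (trans (height²-difference-shift t α x (t - α) d) (ℚ.+-comm (height² t x - height² α x) ((2ℚ * (t - α) * (t - α)) * d)))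
    (*-pos (subst (0ℚ <_) (sym (ℚ.*-assoc 2ℚ (t - α) (t - α))) (*-pos 0<2 (square-pos (p≢q⇒p-q≢0 t≢α)))) 0<d)
    (p≤q⇒0≤q-p hα≤ht))

  height²≤0⇒0<slope : ∀ {α x} → height² α x ≤ 0ℚ → 0ℚ < 2ℚ * (α - x) * (α - x)
  height²≤0⇒0<slope {α} {x} hα≤0 =
    subst (0ℚ <_) (sym (ℚ.*-assoc 2ℚ (α - x) (α - x))) (*-pos 0<2 (square-pos (p≢q⇒p-q≢0 α≢x)))
    where
    α≢x : α ≢ x
    α≢x refl = <⇒≱ (subst (0ℚ <_) (sym (height²-centre α)) (*-pos (0<radius α) (0<radius α))) hα≤0

  -- Minimal covers are unique

  -- If α ∈ S is missing from a cover T, then S without α still covers. A point covered only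
  -- by D_α lies below the top of D_α at an abscissa x where D_α is strictly higher than all
  -- other disks of S (moving x towards α first if it lies on the rim of D_α). T covers that
  -- top point, so some D_t with t ≠ α is at least as high at x; moving x slightly towards t
  -- makes D_t strictly higher than every disk of S, contradicting that S covers D_t.
  module Dispensable {P : ℚ → Set} {S T : List ℚ} (S-minimal : MinimalCover P S) (T-covers : Covers P T)
                     {α : ℚ} (α∈S : α ∈ S) (α∉T : α ∉ T) where

    S-covers : Covers P S
    S-covers = proj₁ (proj₂ S-minimal)

    ≢α? : ∀ β → Dec (β ≢ α)
    ≢α? β = ¬? (β ℚ.≟ α)

    S⁻ : List ℚ
    S⁻ = filter ≢α? S

    S⁻⊆S : ∀ {β} → β ∈ S⁻ → β ∈ S
    S⁻⊆S β∈S⁻ = proj₁ (∈-filter⁻ ≢α? {xs = S} β∈S⁻)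

    α∉S⁻ : α ∉ S⁻
    α∉S⁻ α∈S⁻ = proj₂ (∈-filter⁻ ≢α? {xs = S} α∈S⁻) refl

    dominates-S : ∀ {t x} → height² α x < height² t x → Dominates α S⁻ x → Dominates t S x
    dominates-S {t} {x} hα<ht dominated = All.tabulate above
      where
      above : ∀ {β} → β ∈ S → height² β x < height² t x
      above {β} β∈S with β ℚ.≟ α
      ... | yes refl = hα<ht
      ... | no  β≢α  = ℚ.<-trans (All.lookup dominated (∈-filter⁺ ≢α? β∈S β≢α)) hα<ht

    no-strict-top : ∀ {x} → 0ℚ < height² α x → Dominates α S⁻ x → ⊥
    no-strict-top {x} 0<hα dominated =
      overtaken (find (cover-reaches T-covers (All.lookup (proj₁ S-covers) α∈S) (ℚ.<⇒≤ 0<hα)))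
      where
      overtaken : (∃ λ t → t ∈ T × height² α x ≤ height² t x) → ⊥
      overtaken (t , t∈T , hα≤ht) =
        let d , 0<d , 0<hα′ , dominated′ = nudge (t - α) dominated (inj₁ 0<hα)
            hα′<ht′ = height²-overtakes {α} {t} {x} {d} t≢α hα≤ht 0<d
        in cover-¬dominated S-covers (All.lookup (proj₁ T-covers) t∈T) (ℚ.<⇒≤ (ℚ.<-trans 0<hα′ hα′<ht′))
                            (dominates-S hα′<ht′ dominated′)
        where
        t≢α : t ≢ α
        t≢α refl = α∉T t∈T

    no-top : ∀ {x} → 0ℚ ≤ height² α x → Dominates α S⁻ x → ⊥
    no-top {x} 0≤hα dominated = decide (0ℚ ℚ.<? height² α x)
      where
      decide : Dec (0ℚ < height² α x) → ⊥
      decide (yes 0<hα) = no-strict-top 0<hα dominated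
      decide (no 0≮hα) =
        let hα≤0 = ℚ.≮⇒≥ 0≮hα
            _ , _ , 0<hα′ , dominated′ = nudge (α - x) dominated (inj₂ (ℚ.≤-antisym hα≤0 0≤hα , height²≤0⇒0<slope hα≤0))
        in no-strict-top 0<hα′ dominated′

    S⁻-covers : Covers P S⁻
    S⁻-covers = All.tabulate (λ β∈S⁻ → All.lookup (proj₁ S-covers) (S⁻⊆S β∈S⁻)) , covered
      where
      only-α : ∀ {z} → InDisk z α → All (λ β → ¬ InDisk z β) S⁻ → ⊥
      only-α {x , y} z∈Dα z∉S⁻ = no-top (ℚ.≤-trans (square-nonNeg y) y*y≤hα)
        (All.map (λ {β} z∉Dβ → ℚ.<-≤-trans (ℚ.≰⇒> (z∉Dβ ∘ ≤height²⇒InDisk {x} {y} {β})) y*y≤hα) z∉S⁻)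
        where
        y*y≤hα : y * y ≤ height² α x
        y*y≤hα = InDisk⇒≤height² {x} {y} {α} z∈Dα
      covered : ∀ z q → P q → InDisk z q → Any (InDisk z) S⁻
      covered z q Pq z∈Dq = decide (Any.any? (inDisk? z) S⁻)
        where
        decide : Dec (Any (InDisk z) S⁻) → Any (InDisk z) S⁻
        decide (yes z∈⋃S⁻) = z∈⋃S⁻
        decide (no z∉⋃S⁻) = ⊥-elim (only-in-Dα (find (proj₂ S-covers z q Pq z∈Dq)))
          where
          only-in-Dα : (∃ λ β → β ∈ S × InDisk z β) → ⊥
          only-in-Dα (β , β∈S , z∈Dβ) with β ℚ.≟ α
          ... | yes refl = only-α {z} z∈Dβ (All.¬Any⇒All¬ S⁻ z∉⋃S⁻)
          ... | no β≢α   = z∉⋃S⁻ (lose (∈-filter⁺ ≢α? β∈S β≢α) z∈Dβ)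

    absurd : ⊥
    absurd = α∉S⁻ (proj₂ (proj₂ S-minimal) S⁻ S⁻-covers S⁻⊆S α∈S)

  minimalCover⊆cover : ∀ {P S T} → MinimalCover P S → Covers P T → ∀ {α} → α ∈ S → α ∈ T
  minimalCover⊆cover {T = T} S-minimal T-covers {α} α∈S =
    decidable-stable (α ∈? T) (Dispensable.absurd S-minimal T-covers α∈S)

  -- The reflection q ↦ 1 - q

  mirror : ℚ → ℚ
  mirror q = 1ℚ - q

  mirror-involutive : ∀ q → mirror (mirror q) ≡ q
  mirror-involutive q = solve 1 (λ q → con 1ℚ :- (con 1ℚ :- q) := q) refl q

  mirror-injective : ∀ {p q} → mirror p ≡ mirror q → p ≡ q
  mirror-injective {p} {q} eq = trans (sym (mirror-involutive p)) (trans (cong mirror eq) (mirror-involutive q))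

  mirror-antitone : ∀ {p q} → p ≤ q → mirror q ≤ mirror p
  mirror-antitone {p} {q} p≤q =
    0≤q-p⇒p≤q (subst (0ℚ ≤_) (solve 2 (λ p q → q :- p := (con 1ℚ :- p) :- (con 1ℚ :- q)) refl p q) (p≤q⇒0≤q-p p≤q))

  *≡⇒∣ : ∀ {m n} k → + m ℤ.* k ≡ + n → m ∣ n
  *≡⇒∣ {m} {n} k m*k≡n = divides ℤ.∣ k ∣ (begin
    n                  ≡⟨ cong ℤ.∣_∣ m*k≡n ⟨
    ℤ.∣ + m ℤ.* k ∣    ≡⟨ ℤ.abs-* (+ m) k ⟩
    m ℕ.* ℤ.∣ k ∣      ≡⟨ ℕ.*-comm m ℤ.∣ k ∣ ⟩
    ℤ.∣ k ∣ ℕ.* m      ∎)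
    where open ≡-Reasoning

  ↧ₙ[p+q]∣↧ₙp*↧ₙq : ∀ p q → ℚ.↧ₙ (p + q) ∣ ℚ.↧ₙ p ℕ.* ℚ.↧ₙ q
  ↧ₙ[p+q]∣↧ₙp*↧ₙq p q = *≡⇒∣ _ (ℚ.↧-+ p q)

  ↧ₙ-mirror-∣ : ∀ q → ℚ.↧ₙ (mirror q) ∣ ℚ.↧ₙ q
  ↧ₙ-mirror-∣ q = subst (ℚ.↧ₙ (mirror q) ∣_) (trans (ℕ.*-identityˡ _) (cong ℤ.∣_∣ (ℚ.↧-neg q)))
                        (↧ₙ[p+q]∣↧ₙp*↧ₙq 1ℚ (ℚ.- q))

  ↧ₙ-mirror : ∀ q → ℚ.↧ₙ (mirror q) ≡ ℚ.↧ₙ q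
  ↧ₙ-mirror q = ∣-antisym (↧ₙ-mirror-∣ q)
    (subst (λ p → ℚ.↧ₙ p ∣ ℚ.↧ₙ (mirror q)) (mirror-involutive q) (↧ₙ-mirror-∣ (mirror q)))

  radius-mirror : ∀ q → radius (mirror q) ≡ radius q
  radius-mirror q = cong (λ n → + 1 ℚ./ suc n) (ℕ.suc-injective (↧ₙ-mirror q))

  mirror-frac : ∀ a k → a ℕ.≤ suc k → mirror (frac a (suc k)) ≡ frac (suc k ∸ a) (suc k)
  mirror-frac a k a≤N = ℚ.toℚᵘ-injective (begin
    ℚ.toℚᵘ (1ℚ + ℚ.- frac a N)                  ≈⟨ ℚ.toℚᵘ-homo-+ 1ℚ (ℚ.- frac a N) ⟩
    ℚ.toℚᵘ 1ℚ ℚᵘ.+ ℚ.toℚᵘ (ℚ.- frac a N)        ≈⟨ ℚᵘ.+-congʳ (ℚ.toℚᵘ 1ℚ) (ℚ.toℚᵘ-homo‿- (frac a N)) ⟩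
    ℚ.toℚᵘ 1ℚ ℚᵘ.+ ℚᵘ.- ℚ.toℚᵘ (frac a N)       ≈⟨ ℚᵘ.+-congʳ (ℚ.toℚᵘ 1ℚ) (ℚᵘ.-‿cong (ℚ.toℚᵘ-fromℚᵘ (ℚᵘ.mkℚᵘ (+ a) k))) ⟩
    ℚ.toℚᵘ 1ℚ ℚᵘ.+ ℚᵘ.- ℚᵘ.mkℚᵘ (+ a) k         ≈⟨ ℚᵘ.*≡* cross-multiplied ⟩
    ℚᵘ.mkℚᵘ (+ (N ∸ a)) k                       ≈⟨ ℚ.toℚᵘ-fromℚᵘ (ℚᵘ.mkℚᵘ (+ (N ∸ a)) k) ⟨
    ℚ.toℚᵘ (frac (N ∸ a) N)                     ∎)
    where
    open ℚᵘ.≃-Reasoning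
    open ℤ-Solver.+-*-Solver using () renaming (solve to ℤ-solve; _:+_ to _⊕_; _:*_ to _⊗_; _:-_ to _⊖_; :-_ to ⊝_; con to ℤ-con; _:=_ to _≐_)
    N : ℕ
    N = suc k
    cross-multiplied : (+ 1 ℤ.* + N ℤ.+ (ℤ.- + a) ℤ.* + 1) ℤ.* + N ≡ + (N ∸ a) ℤ.* + (1 ℕ.* N)
    cross-multiplied = trans
      (ℤ-solve 2 (λ n a → (ℤ-con (+ 1) ⊗ n ⊕ (⊝ a) ⊗ ℤ-con (+ 1)) ⊗ n ≐ (n ⊖ a) ⊗ n) refl (+ N) (+ a))
      (cong₂ ℤ._*_ (trans (ℤ.m-n≡m⊖n N a) (ℤ.⊖-≥ a≤N)) (cong +_ (sym (ℕ.*-identityˡ N))))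

  InDisk-mirror : ∀ x y q → InDisk (mirror x , y) (mirror q) ⇔ InDisk (x , y) q
  InDisk-mirror x y q = mk⇔ (subst id same) (subst id (sym same))
    where
    same : InDisk (mirror x , y) (mirror q) ≡ InDisk (x , y) q
    same = cong₂ _≤_
      (cong (_+ y * y) (solve 2 (λ x q → ((con 1ℚ :- x) :- (con 1ℚ :- q)) :* ((con 1ℚ :- x) :- (con 1ℚ :- q))
                                           := (x :- q) :* (x :- q)) refl x q))
      (cong (λ r → r * r) (radius-mirror q))

  Adm-mirror : ∀ {N q} → Adm N q → Adm N (mirror q)
  Adm-mirror {N} {q} (0≤q , q≤1 , N∣↧q) =
    mirror-antitone q≤1 , mirror-antitone 0≤q , subst (N ∣_) (sym (↧ₙ-mirror q)) N∣↧q

  [1+a+b]∸a≡1+b : ∀ a b → suc (a ℕ.+ b) ∸ a ≡ suc b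
  [1+a+b]∸a≡1+b a b = trans (ℕ.+-∸-assoc 1 (ℕ.m≤m+n a b)) (cong suc (ℕ.m+n∸m≡n a b))

  AdmR-mirror : ∀ {N a b q} → N ≡ suc (a ℕ.+ b) → next N a ≡ suc a → next N b ≡ suc b →
                AdmR N a q → AdmR N b (mirror q)
  AdmR-mirror {a = a} {b} {q} refl next-a next-b (adm , lower , upper) = Adm-mirror adm ,
    subst (_≤ mirror q) (trans (mirror-frac (suc a) (a ℕ.+ b) (s≤s (ℕ.m≤m+n a b))) (cong (λ n → frac n N) (ℕ.m+n∸m≡n a b)))
          (mirror-antitone (subst (λ n → q ≤ frac n N) next-a upper)) ,
    subst (mirror q ≤_) (trans (mirror-frac a (a ℕ.+ b) (ℕ.m≤n⇒m≤1+n (ℕ.m≤m+n a b)))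
                               (cong (λ n → frac n N) (trans ([1+a+b]∸a≡1+b a b) (sym next-b))))
          (mirror-antitone lower)
    where
    N : ℕ
    N = suc (a ℕ.+ b)

  Covers-mirror : ∀ {P Q : ℚ → Set} {T} → (∀ {q} → P q → Q (mirror q)) → (∀ {q} → Q q → P (mirror q)) →
                  Covers Q T → Covers P (map mirror T)
  Covers-mirror {P} {Q} {T} P⇒Q∘mirror Q⇒P∘mirror (all-Q , covers) = All.map⁺ (All.map Q⇒P∘mirror all-Q) , covered
    where
    covered : ∀ z q → P q → InDisk z q → Any (InDisk z) (map mirror T)
    covered (x , y) q Pq z∈Dq =
      let β , β∈T , z̄∈Dβ = find (covers (mirror x , y) (mirror q) (P⇒Q∘mirror Pq) (Equivalence.from (InDisk-mirror x y q) z∈Dq))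
      in Any.map⁺ (lose β∈T (Equivalence.to (InDisk-mirror x y (mirror β))
                               (subst (λ β′ → InDisk (mirror x , y) β′) (sym (mirror-involutive β)) z̄∈Dβ)))

  mirror-↭ : ∀ {P Q : ℚ → Set} {S S′} → MinimalCover P S → MinimalCover Q S′ →
             (∀ {q} → P q → Q (mirror q)) → (∀ {q} → Q q → P (mirror q)) → map mirror S′ ↭ S
  mirror-↭ {S = S} {S′} S-minimal S′-minimal P⇒Q∘mirror Q⇒P∘mirror =
    ∼bag⇒↭ (unique∧set⇒bag (Unique.map⁺ mirror-injective (proj₁ S′-minimal)) (proj₁ S-minimal) (mk⇔ ⊆S S⊆))
    where
    S⊆ : ∀ {q} → q ∈ S → q ∈ map mirror S′
    S⊆ = minimalCover⊆cover S-minimal (Covers-mirror P⇒Q∘mirror Q⇒P∘mirror (proj₁ (proj₂ S′-minimal)))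
    S′⊆ : ∀ {q} → q ∈ S′ → q ∈ map mirror S
    S′⊆ = minimalCover⊆cover S′-minimal (Covers-mirror Q⇒P∘mirror P⇒Q∘mirror (proj₁ (proj₂ S-minimal)))
    ⊆S : ∀ {q} → q ∈ map mirror S′ → q ∈ S
    ⊆S q∈mirror[S′] =
      let p , p∈S′ , q≡p̄ = ∈-map⁻ mirror q∈mirror[S′]
          r , r∈S , p≡r̄ = ∈-map⁻ mirror (S′⊆ p∈S′)
      in subst (_∈ S) (sym (trans q≡p̄ (trans (cong mirror p≡r̄) (mirror-involutive r)))) r∈S

open Disks

open import Data.Nat using (ℕ; suc; _<_; _∸_)
open import Data.Nat.GCD using (gcd)
open import Data.Product using (_×_)
open import Data.List using (List)
open import Data.Rational using (ℚ)
open import Relation.Binary.PropositionalEquality using (_≡_)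

open import Data.List using ([]; _∷_; map; filter; length; foldr)
open import Data.List.Properties using (map-∘; map-cong)
open import Data.List.Relation.Binary.Permutation.Propositional using (_↭_; ↭-sym; ↭⇒↭ₛ)
import Data.List.Relation.Binary.Permutation.Propositional.Properties as ↭
open import Data.List.Relation.Binary.Permutation.Setoid.Properties using (foldr-commMonoid)
open import Data.Nat as ℕ using (_⊔_; _+_; _≤_; z≤n; s≤s; NonZero)
import Data.Nat.Properties as ℕ
open import Data.Nat.Divisibility using (_∣_; ∣m+n∣m⇒∣n; ∣⇒≤)
open import Data.Nat.GCD using (gcd-greatest; gcd[m,n]∣m; gcd[m,n]∣n; gcd[m,n]≢0)
open import Data.Product using (_,_; proj₂)
open import Data.Sum using (inj₁)
open import Function using (_∘_)
open import Function.Bundles using (_⇔_; Equivalence)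
open import Relation.Binary.PropositionalEquality using (refl; sym; trans; cong; subst; setoid; module ≡-Reasoning)
open import Relation.Nullary using (yes; no; contradiction)
open import Relation.Unary using (Decidable)

length-filter-map : ∀ {A B : Set} {P : B → Set} {Q : A → Set} (P? : Decidable P) (Q? : Decidable Q) (f : A → B) →
                    (∀ x → P (f x) ⇔ Q x) → ∀ xs → length (filter P? (map f xs)) ≡ length (filter Q? xs)
length-filter-map P? Q? f P∘f⇔Q [] = refl
length-filter-map P? Q? f P∘f⇔Q (x ∷ xs) with P? (f x) | Q? x
... | yes _   | yes _  = cong suc (length-filter-map P? Q? f P∘f⇔Q xs)
... | yes Pfx | no ¬Qx = contradiction (Equivalence.to (P∘f⇔Q x) Pfx) ¬Qx
... | no ¬Pfx | yes Qx = contradiction (Equivalence.from (P∘f⇔Q x) Qx) ¬Pfx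
... | no _    | no _   = length-filter-map P? Q? f P∘f⇔Q xs

cnt-map-mirror : ∀ L α → cnt (map mirror L) (mirror α) ≡ cnt L α
cnt-map-mirror L α = length-filter-map (inDisk? (Pt (mirror α))) (inDisk? (Pt α)) mirror mirrored-point L
  where
  mirrored-point : ∀ β → InDisk (Pt (mirror α)) (mirror β) ⇔ InDisk (Pt α) β
  mirrored-point β = subst (λ r → InDisk (mirror α , r) (mirror β) ⇔ InDisk (Pt α) β) (sym (radius-mirror α))
                           (InDisk-mirror α (radius α) β)

cnt-↭ : ∀ {L L′} → L ↭ L′ → ∀ α → cnt L α ≡ cnt L′ α
cnt-↭ L↭L′ α = ↭.↭-length (↭.filter-↭ (inDisk? (Pt α)) L↭L′)

cmax-mirror : ∀ {SN S₁ S₂} → map mirror SN ↭ SN → map mirror S₂ ↭ S₁ → cmax SN S₁ ≡ cmax SN S₂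
cmax-mirror {SN} {S₁} {S₂} mirror[SN]↭SN mirror[S₂]↭S₁ = begin
  foldr _⊔_ 0 (map (cnt SN) S₁)               ≡⟨ foldr-commMonoid (setoid ℕ) ℕ.⊔-0-isCommutativeMonoid
                                                   (↭⇒↭ₛ (↭.map⁺ (cnt SN) (↭-sym mirror[S₂]↭S₁))) ⟩
  foldr _⊔_ 0 (map (cnt SN) (map mirror S₂))  ≡⟨ cong (foldr _⊔_ 0) (map-∘ S₂) ⟨
  foldr _⊔_ 0 (map (cnt SN ∘ mirror) S₂)      ≡⟨ cong (foldr _⊔_ 0) (map-cong cnt-mirror S₂) ⟩
  foldr _⊔_ 0 (map (cnt SN) S₂)               ∎
  where
  open ≡-Reasoning
  cnt-mirror : ∀ α → cnt SN (mirror α) ≡ cnt SN α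
  cnt-mirror α = trans (cnt-↭ (↭-sym mirror[SN]↭SN) (mirror α)) (cnt-map-mirror SN α)

nextAux-hit : ∀ N f k → 1 < gcd N k → nextAux N f k ≡ k
nextAux-hit N ℕ.zero  k _ = refl
nextAux-hit N (suc f) k 1<gcd[N,k] with 1 ℕ.<? gcd N k
... | yes _          = refl
... | no  1≮gcd[N,k] = contradiction 1<gcd[N,k] 1≮gcd[N,k]

next-≡-suc : ∀ {N n} → 1 < gcd N (suc n) → next N n ≡ suc n
next-≡-suc {N} {n} = nextAux-hit N (N ∸ n ∸ 1) (suc n)

∣m∣n⇒∣m∸n : ∀ {d m n} → n ≤ m → d ∣ m → d ∣ n → d ∣ m ∸ n
∣m∣n⇒∣m∸n {d} n≤m d∣m d∣n = ∣m+n∣m⇒∣n (subst (d ∣_) (sym (ℕ.m+[n∸m]≡n n≤m)) d∣m) d∣n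

1<gcd[m,n]⇒1<gcd[m,m∸n] : ∀ {m n} .{{_ : NonZero m}} → n ≤ m → 1 < gcd m n → 1 < gcd m (m ∸ n)
1<gcd[m,n]⇒1<gcd[m,m∸n] {m} {n} n≤m 1<gcd[m,n] = ℕ.<-≤-trans 1<gcd[m,n]
  (∣⇒≤ {{ℕ.≢-nonZero (gcd[m,n]≢0 m (m ∸ n) (inj₁ (ℕ.≢-nonZero⁻¹ m)))}}
       (gcd-greatest (gcd[m,n]∣m m n) (∣m∣n⇒∣m∸n n≤m (gcd[m,n]∣m m n) (gcd[m,n]∣n m n))))

m∸n∸1≡m∸[1+n] : ∀ m n → m ∸ n ∸ 1 ≡ m ∸ suc n
m∸n∸1≡m∸[1+n] m n = trans (ℕ.∸-+-assoc m n 1) (cong (m ∸_) (ℕ.+-comm n 1))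

N≡1+n+[N∸n∸1] : ∀ {N n} → n < N → N ≡ suc (n + (N ∸ n ∸ 1))
N≡1+n+[N∸n∸1] {N} {n} n<N = sym (trans (cong (suc n +_) (m∸n∸1≡m∸[1+n] N n)) (ℕ.m+[n∸m]≡n n<N))

complement-admissible : ∀ {N n} → 1 < N → n < N → 1 < gcd N n → 1 < gcd N (suc n) →
                        (N ∸ n ∸ 1) < N × 1 < gcd N (N ∸ n ∸ 1) × 1 < gcd N (suc (N ∸ n ∸ 1))
complement-admissible {N} {n} 1<N n<N 1<gcd[N,n] 1<gcd[N,1+n] = m<N , 1<gcd[N,m] , 1<gcd[N,1+m]
  where
  instance
    nonZero-N : NonZero N
    nonZero-N = ℕ.>-nonZero (ℕ.<-trans (s≤s z≤n) 1<N)
  m : ℕ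
  m = N ∸ n ∸ 1
  m<N : m < N
  m<N = subst (m <_) (sym (N≡1+n+[N∸n∸1] n<N)) (s≤s (ℕ.m≤n+m m n))
  1<gcd[N,m] : 1 < gcd N m
  1<gcd[N,m] = subst (λ k → 1 < gcd N k) (sym (m∸n∸1≡m∸[1+n] N n)) (1<gcd[m,n]⇒1<gcd[m,m∸n] n<N 1<gcd[N,1+n])
  1<gcd[N,1+m] : 1 < gcd N (suc m)
  1<gcd[N,1+m] = subst (λ k → 1 < gcd N k) (trans (cong (_∸ n) (N≡1+n+[N∸n∸1] n<N)) ([1+a+b]∸a≡1+b n m))
                       (1<gcd[m,n]⇒1<gcd[m,m∸n] (ℕ.<⇒≤ n<N) 1<gcd[N,n])

lemma2p6 : (N n : ℕ) → 1 < N → n < N → 1 < gcd N n → 1 < gcd N (suc n) →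
    ((N ∸ n ∸ 1) < N × 1 < gcd N (N ∸ n ∸ 1) × 1 < gcd N (suc (N ∸ n ∸ 1))) ×
    ((SN S1 S2 : List ℚ) → MinimalCover (Adm N) SN →
      MinimalCover (AdmR N n) S1 → MinimalCover (AdmR N (N ∸ n ∸ 1)) S2 →
      cmax SN S1 ≡ cmax SN S2)
lemma2p6 N n 1<N n<N 1<gcd[N,n] 1<gcd[N,1+n] = m-admissible ,
  λ SN S₁ S₂ SN-minimal S₁-minimal S₂-minimal →
    cmax-mirror (mirror-↭ SN-minimal SN-minimal (Adm-mirror {N}) (Adm-mirror {N}))
                (mirror-↭ S₁-minimal S₂-minimal (AdmR-mirror N≡1+n+m next-n next-m)
                                                (AdmR-mirror N≡1+m+n next-m next-n))
  where
  m : ℕ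
  m = N ∸ n ∸ 1
  m-admissible : m < N × 1 < gcd N m × 1 < gcd N (suc m)
  m-admissible = complement-admissible 1<N n<N 1<gcd[N,n] 1<gcd[N,1+n]
  N≡1+n+m : N ≡ suc (n + m)
  N≡1+n+m = N≡1+n+[N∸n∸1] n<N
  N≡1+m+n : N ≡ suc (m + n)
  N≡1+m+n = trans N≡1+n+m (cong suc (ℕ.+-comm n m))
  next-n : next N n ≡ suc n
  next-n = next-≡-suc 1<gcd[N,1+n]
  next-m : next N m ≡ suc m
  next-m = next-≡-suc (proj₂ (proj₂ m-admissible))
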